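{- For $n \geq 3$ and $v \in A_n$, $$cyc(v) = \begin{cases} n - \ell_{T(A_n)}(v) & \text{if } \ell_{T(A_n)}(v) \text{ is even},\\ n - \ell_{T(A_n)}(v) - 1 & \text{if } \ell_{T(A_n)}(v) \text{ is odd}.\end{cases}$$
   Context: $A_n$ is the alternating group on $\{1,\dots,n\}$. $cyc(v)$ is the number of cycles in the disjoint cycle decomposition of $v$, with fixed points counted as cycles. Set $T(A_n) = \{(1\,2)(i\,j) \mid 1 \le i<j \le n\}$, a generating set of $A_n$. The length $\ell_{T(A_n)}(v)$ is the minimal $k\ge0$ such that $v$ is a product of $k$ elements of $T(A_n)$. -}

module Defs where

open import Data.Nat using (ℕ; zero; suc; _≤ᵇ_; _%_; _<_; _≤_)
open import Data.Fin using (Fin; toℕ)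
open import Data.Fin.Permutation using (Permutation′; _⟨$⟩ʳ_; _∘ₚ_; _≈_; transpose; id)
open import Data.List using (List; []; _∷_; length; map; allFin; upTo; foldr)
open import Data.List.Relation.Unary.All using (All)
open import Data.Nat.ListAction using (sum)
open import Data.Bool using (Bool; true; _∧_; if_then_else_)
open import Data.Product using (Σ; ∃; _×_; _,_)
open import Relation.Binary.PropositionalEquality using (_≡_; _≢_)
open import Relation.Nullary using (¬_)

-- Convention: permutations of {1,…,n} are Permutation′ n on Fin n
-- (point k of the paper is the Fin element with toℕ = k - 1).
-- Products: we write  σ · τ  for "apply τ first, then σ" (right-to-left,
-- usual convention for cycle notation), i.e.  σ · τ = τ ∘ₚ σ  in stdlib.
_·_ : ∀ {n} → Permutation′ n → Permutation′ n → Permutation′ n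
σ · τ = τ ∘ₚ σ

prod : ∀ {n} → List (Permutation′ n) → Permutation′ n
prod = foldr _·_ id

IsTransposition : ∀ {n} → Permutation′ n → Set
IsTransposition {n} t = Σ (Fin n) λ i → Σ (Fin n) λ j → (i ≢ j) × (t ≈ transpose i j)

EvenNat : ℕ → Set
EvenNat k = k % 2 ≡ 0

OddNat : ℕ → Set
OddNat k = k % 2 ≡ 1

InAlternating : ∀ {n} → Permutation′ n → Set
InAlternating {n} v =
  Σ (List (Permutation′ n)) λ ts →
    All IsTransposition ts × EvenNat (length ts) × (v ≈ prod ts)

InT : ∀ {n} → Permutation′ n → Set
InT {n} t =
  Σ (Fin n) λ a → Σ (Fin n) λ b → Σ (Fin n) λ i → Σ (Fin n) λ j →
    (toℕ a ≡ 0) × (toℕ b ≡ 1) × (toℕ i < toℕ j) ×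
    (t ≈ (transpose a b · transpose i j))

ProductOfT : ∀ {n} → Permutation′ n → ℕ → Set
ProductOfT {n} v k =
  Σ (List (Permutation′ n)) λ ts →
    All InT ts × (length ts ≡ k) × (v ≈ prod ts)

IsTLength : ∀ {n} → Permutation′ n → ℕ → Set
IsTLength v k = ProductOfT v k × (∀ m → ProductOfT v m → k ≤ m)

iter : ∀ {n} → Permutation′ n → ℕ → Fin n → Fin n
iter v zero    i = i
iter v (suc k) i = v ⟨$⟩ʳ (iter v k i)

-- i is the least element of its cycle (orbit under ⟨v⟩); every orbit has
-- size ≤ n, so the orbit of i is { v^k(i) | k < n }.
isCycleMin : ∀ {n} → Permutation′ n → Fin n → Bool
isCycleMin {n} v i = foldr _∧_ true (map (λ k → toℕ i ≤ᵇ toℕ (iter v k i)) (upTo n))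

-- cyc(v): number of cycles of v (fixed points included), counted as the
-- number of cycles' least elements.
cyc : ∀ {n} → Permutation′ n → ℕ
cyc {n} v = sum (map (λ i → if isCycleMin v i then 1 else 0) (allFin n))

module Submission where

-- (0) Cycles are handled through orbits v⁰(x), v¹(x), …; cyc v is the sum
--     over Fin n of the indicator of "x is least on its cycle".
-- (1) Left multiplication by a transposition (a b) changes cyc by exactly one:
--     it splits the cycle through a and b if there is one (split, cyc-split),
--     and otherwise merges the cycles of a and b (Merge).  Hence a product of
--     k transpositions has cyc ≥ n − k and cyc + k ≡ n (mod 2), and every w is
--     a product of n − cyc w transpositions (decompose).
-- (2) Pushing the σ's of a product σ(i₁ j₁)⋯σ(iₖ jₖ) to the front conjugates
--     each (i j) into another transposition, so v is a product of k elements
--     of T iff σᵏ·v is a product of k transpositions (twist, untwist).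
-- (3) Let w = v if 1 and 2 lie on different cycles of v, and w = σ·v
--     otherwise.  Then 1, 2 lie on different cycles of w, so cyc(σʳ·w) ≤ cyc w
--     for all r, and (1), (2) give ℓ_T(v) = n − cyc w (T-length); comparing
--     cyc v with cyc w yields the formula.
-- Points of {1,…,n} are elements of Fin n, so 1 and 2 are 0F and 1F below.

open import Defs
open import Data.Nat using (ℕ; _≤_; _∸_)
open import Data.Fin.Permutation using (Permutation′)
open import Data.Product using (Σ; _×_)
open import Relation.Binary.PropositionalEquality using (_≡_)

open import Algebra.Properties.CommutativeMonoid.Sum as Sum using ()
open import Data.Bool using (Bool; true; false; T; if_then_else_; _∧_)
open import Data.Empty using (⊥-elim)
open import Data.Fin using (Fin; toℕ; fromℕ<; _≟_) renaming (suc to fsuc)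
open import Data.Fin.Patterns using (0F; 1F)
import Data.Fin.Properties as Fin
open import Data.Fin.Permutation using (_⟨$⟩ʳ_; _⟨$⟩ˡ_; inverseˡ; _≈_; transpose; id)
open import Data.List using (List; []; _∷_; length; map; upTo; allFin; tabulate; foldr)
open import Data.List.Membership.Propositional.Properties using (∈-map⁺; ∈-map⁻; ∈-upTo⁺)
open import Data.List.Properties using (map-tabulate; map-cong)
open import Data.List.Relation.Unary.All as All using (All; []; _∷_)
open import Data.List.Relation.Unary.All.Properties using (all⁺; all⁻)
open import Data.Nat using (zero; suc; _+_; _*_; _<_; _≤ᵇ_; z≤n; s≤s; s≤s⁻¹; _%_; _/_; >-nonZero; parity)
open import Data.Nat.DivMod using (m%n<n; m≡m%n+[m/n]*n)
import Data.Nat.ListAction as List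
open import Data.Nat.Properties
  using (≤-refl; ≤-trans; ≤-antisym; ≤-reflexive; <⇒≤; <⇒≢; <-≤-trans; n<1+n; n≤1+n; 1+n≰n;
         m∸n≤m; m<n⇒0<n∸m; m∸n+n≡m; m+[n∸m]≡n; m∸[m∸n]≡n; m≤n+o⇒m∸n≤o; ∸-monoʳ-<;
         m≤n⇒m<n∨m≡n; m≤m*n; +-comm; +-suc; +-identityʳ; +-mono-≤; +-monoˡ-≤; m+1+n≢m;
         ≤ᵇ⇒≤; ≤⇒≤ᵇ; ≤-totalOrder; +-0-commutativeMonoid; module ≤-Reasoning)
open import Data.Parity using (Parity; 0ℙ; 1ℙ; _⁻¹) renaming (_+_ to _ℙ+_)
import Data.Parity.Properties as ℙ
open import Data.Parity.Properties using (+-homo-+; suc-homo-⁻¹)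
open import Data.Product using (∃; _,_)
open import Data.Sum using (_⊎_; inj₁; inj₂)
open import Data.Unit using (tt)
open import Function using (_∘_)
open import Relation.Binary.Definitions using (tri<; tri≈; tri>)
open import Relation.Binary.PropositionalEquality
  using (_≢_; ≢-sym; refl; sym; trans; cong; cong₂; subst; module ≡-Reasoning)
open import Relation.Nullary using (¬_; Dec; yes; no; does; ¬?)
open import Relation.Nullary.Decidable using (map′; decidable-stable)
open import Data.List.Extrema ≤-totalOrder using (argmin; f[argmin]≤f[xs]; argmin-sel)
open Sum +-0-commutativeMonoid using (sum-replicate-zero; sum-cong-≗; ∑-distrib-+) renaming (sum to ∑)

ap : ∀ {n} → Permutation′ n → Fin n → Fin n
ap = _⟨$⟩ʳ_

tr : ∀ {n} → Fin n → Fin n → Fin n → Fin n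
tr i j = ap (transpose i j)

tr-i : ∀ {n} (i j : Fin n) → tr i j i ≡ j
tr-i i j with i ≟ i
... | yes _ = refl
... | no i≢i = ⊥-elim (i≢i refl)

tr-j : ∀ {n} (i j : Fin n) → tr i j j ≡ i
tr-j i j with j ≟ i
... | yes j≡i = j≡i
... | no _ with j ≟ j
...   | yes _ = refl
...   | no j≢j = ⊥-elim (j≢j refl)

tr-other : ∀ {n} (i j k : Fin n) → k ≢ i → k ≢ j → tr i j k ≡ k
tr-other i j k k≢i k≢j with k ≟ i
... | yes k≡i = ⊥-elim (k≢i k≡i)
... | no _ with k ≟ j
...   | yes k≡j = ⊥-elim (k≢j k≡j)
...   | no _ = refl

data Position {n} (i j k : Fin n) : Set where
  at-i      : k ≡ i → Position i j k
  at-j      : k ≢ i → k ≡ j → Position i j k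
  elsewhere : k ≢ i → k ≢ j → Position i j k

position : ∀ {n} (i j k : Fin n) → Position i j k
position i j k with k ≟ i | k ≟ j
... | yes k≡i | _       = at-i k≡i
... | no k≢i  | yes k≡j = at-j k≢i k≡j
... | no k≢i  | no k≢j  = elsewhere k≢i k≢j

tr-involutive : ∀ {n} (i j k : Fin n) → tr i j (tr i j k) ≡ k
tr-involutive i j k with position i j k
... | at-i refl = trans (cong (tr i j) (tr-i i j)) (tr-j i j)
... | at-j _ refl = trans (cong (tr i j) (tr-j i j)) (tr-i i j)
... | elsewhere k≢i k≢j = trans (cong (tr i j) (tr-other i j k k≢i k≢j)) (tr-other i j k k≢i k≢j)

tr-sym : ∀ {n} (i j k : Fin n) → tr i j k ≡ tr j i k
tr-sym i j k with position i j k
... | at-i refl = trans (tr-i i j) (sym (tr-j j i))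
... | at-j _ refl = trans (tr-j i j) (sym (tr-i j i))
... | elsewhere k≢i k≢j = trans (tr-other i j k k≢i k≢j) (sym (tr-other j i k k≢j k≢i))

tr-conj : ∀ {n} (g : Fin n → Fin n) → (∀ {x y} → g x ≡ g y → x ≡ y) →
          (i j k : Fin n) → g (tr i j k) ≡ tr (g i) (g j) (g k)
tr-conj g g-inj i j k with position i j k
... | at-i refl = trans (cong g (tr-i i j)) (sym (tr-i (g i) (g j)))
... | at-j _ refl = trans (cong g (tr-j i j)) (sym (tr-j (g i) (g j)))
... | elsewhere k≢i k≢j = trans (cong g (tr-other i j k k≢i k≢j))
        (sym (tr-other (g i) (g j) (g k) (k≢i ∘ g-inj) (k≢j ∘ g-inj)))

module _ {n : ℕ} (v : Permutation′ n) where

  SameCycle : Fin n → Fin n → Set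
  SameCycle x y = Σ ℕ λ k → iter v k x ≡ y

  iter-+ : ∀ j k x → iter v (j + k) x ≡ iter v j (iter v k x)
  iter-+ zero    k x = refl
  iter-+ (suc j) k x = cong (ap v) (iter-+ j k x)

  iter-injective : ∀ k {x y} → iter v k x ≡ iter v k y → x ≡ y
  iter-injective zero    e = e
  iter-injective (suc k) e =
    iter-injective k (trans (sym (inverseˡ v)) (trans (cong (v ⟨$⟩ˡ_) e) (inverseˡ v)))

  -- Every point returns to itself after some p ∈ [1, n] steps (pigeonhole on
  -- x, v(x), …, vⁿ(x)).
  period : ∀ x → Σ ℕ λ p → 0 < p × p ≤ n × iter v p x ≡ x
  period x with Fin.pigeonhole (n<1+n n) (λ k → iter v (toℕ k) x)
  ... | i , j , i<j , vⁱx≡vʲx = toℕ j ∸ toℕ i , m<n⇒0<n∸m i<j ,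
        ≤-trans (m∸n≤m (toℕ j) (toℕ i)) (s≤s⁻¹ (Fin.toℕ<n j)) , iter-injective (toℕ i) returns
    where
    p = toℕ j ∸ toℕ i
    returns : iter v (toℕ i) (iter v p x) ≡ iter v (toℕ i) x
    returns = begin
      iter v (toℕ i) (iter v p x) ≡⟨ sym (iter-+ (toℕ i) p x) ⟩
      iter v (toℕ i + p) x        ≡⟨ cong (λ k → iter v k x) (+-comm (toℕ i) p) ⟩
      iter v (p + toℕ i) x        ≡⟨ cong (λ k → iter v k x) (m∸n+n≡m (<⇒≤ i<j)) ⟩
      iter v (toℕ j) x            ≡⟨ sym vⁱx≡vʲx ⟩
      iter v (toℕ i) x            ∎
      where open ≡-Reasoning

  iter-period-multiple : ∀ p x → iter v p x ≡ x → ∀ q → iter v (q * p) x ≡ x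
  iter-period-multiple p x vᵖx≡x zero    = refl
  iter-period-multiple p x vᵖx≡x (suc q) =
    trans (iter-+ p (q * p) x) (trans (cong (iter v p) (iter-period-multiple p x vᵖx≡x q)) vᵖx≡x)

  same-refl : ∀ x → SameCycle x x
  same-refl x = 0 , refl

  same-trans : ∀ {x y z} → SameCycle x y → SameCycle y z → SameCycle x z
  same-trans {x} (j , refl) (k , refl) = k + j , iter-+ k j x

  same-step : ∀ {x y} → SameCycle x y → SameCycle x (ap v y)
  same-step (k , e) = suc k , cong (ap v) e

  -- Going backwards along a cycle is going forwards (k·p − k) steps.
  same-sym : ∀ {x y} → SameCycle x y → SameCycle y x
  same-sym {x} (k , refl) with period x
  ... | p , 0<p , _ , vᵖx≡x = k * p ∸ k , (begin
      iter v (k * p ∸ k) (iter v k x) ≡⟨ sym (iter-+ (k * p ∸ k) k x) ⟩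
      iter v (k * p ∸ k + k) x        ≡⟨ cong (λ j → iter v j x) (m∸n+n≡m (m≤m*n k p)) ⟩
      iter v (k * p) x                ≡⟨ iter-period-multiple p x vᵖx≡x k ⟩
      x                               ∎)
    where
    open ≡-Reasoning
    instance _ = >-nonZero 0<p

  -- A point of the cycle is reached in fewer than n steps (reduce k mod p).
  same-bounded : ∀ {x y} → SameCycle x y → Σ ℕ λ k → k < n × iter v k x ≡ y
  same-bounded {x} (k , refl) with period x
  ... | suc p′ , _ , p≤n , vᵖx≡x = k % p , <-≤-trans (m%n<n k p) p≤n , sym (begin
      iter v k x                           ≡⟨ cong (λ j → iter v j x) (m≡m%n+[m/n]*n k p) ⟩
      iter v (k % p + (k / p) * p) x       ≡⟨ iter-+ (k % p) ((k / p) * p) x ⟩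
      iter v (k % p) (iter v (k / p * p) x) ≡⟨ cong (iter v (k % p))
                                                   (iter-period-multiple p x vᵖx≡x (k / p)) ⟩
      iter v (k % p) x                     ∎)
    where
    open ≡-Reasoning
    p = suc p′

  iter-fromℕ< : ∀ {k} (k<n : k < n) x → iter v (toℕ (fromℕ< k<n)) x ≡ iter v k x
  iter-fromℕ< k<n x = cong (λ j → iter v j x) (Fin.toℕ-fromℕ< k<n)

  same-cycle? : ∀ x y → Dec (SameCycle x y)
  same-cycle? x y = map′ (λ (k , e) → toℕ k , e) reach-in-Fin
    (Fin.any? (λ (k : Fin n) → iter v (toℕ k) x ≟ y))
    where
    reach-in-Fin : SameCycle x y → ∃ λ (k : Fin n) → iter v (toℕ k) x ≡ y
    reach-in-Fin xy with same-bounded xy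
    ... | k , k<n , e = fromℕ< k<n , trans (iter-fromℕ< k<n x) e

  first-arrival : ∀ {x y} → SameCycle x y →
                  Σ ℕ λ r → iter v r x ≡ y × (∀ j → j < r → iter v j x ≢ y)
  first-arrival {x} {y} xy with same-bounded xy
  ... | k , k<n , vᵏx≡y
    with Fin.¬∀⟶∃¬-smallest n (λ i → iter v (toℕ i) x ≢ y) (λ i → ¬? (iter v (toℕ i) x ≟ y))
                              (λ misses → misses (fromℕ< k<n) (trans (iter-fromℕ< k<n x) vᵏx≡y))
  ... | r , arrives , earlier = toℕ r , decidable-stable (iter v (toℕ r) x ≟ y) arrives , misses
    where
    misses : ∀ j → j < toℕ r → iter v j x ≢ y
    misses j j<r = subst (λ i → iter v i x ≢ y)
      (trans (Fin.toℕ-inject (fromℕ< j<r)) (Fin.toℕ-fromℕ< j<r)) (earlier (fromℕ< j<r))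

module _ {n : ℕ} (v : Permutation′ n) where

  IsLeastOnCycle : Fin n → Set
  IsLeastOnCycle x = ∀ y → SameCycle v x y → toℕ x ≤ toℕ y

  -- isCycleMin inspects v⁰(x), …, vⁿ⁻¹(x), which is the whole cycle of x.
  isCycleMin⇒least : ∀ x → T (isCycleMin v x) → IsLeastOnCycle x
  isCycleMin⇒least x t y xy with same-bounded v xy
  ... | k , k<n , refl =
    ≤ᵇ⇒≤ (toℕ x) (toℕ (iter v k x)) (All.lookup (all⁺ _ (upTo n) t) (∈-upTo⁺ k<n))

  least⇒isCycleMin : ∀ x → IsLeastOnCycle x → T (isCycleMin v x)
  least⇒isCycleMin x least = all⁻ (λ k → toℕ x ≤ᵇ toℕ (iter v k x)) {upTo n}
    (All.tabulate (λ {k} _ → ≤⇒≤ᵇ (least (iter v k x) (k , refl))))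

  orbit : Fin n → List (Fin n)
  orbit a = map (λ k → iter v k a) (upTo n)

  cycleMin : Fin n → Fin n
  cycleMin a = argmin toℕ a (orbit a)

  cycleMin-on-cycle : ∀ a → SameCycle v a (cycleMin a)
  cycleMin-on-cycle a with argmin-sel toℕ a (orbit a)
  ... | inj₁ m≡a = subst (SameCycle v a) (sym m≡a) (same-refl v a)
  ... | inj₂ m∈orbit with ∈-map⁻ (λ k → iter v k a) m∈orbit
  ...   | k , _ , m≡vᵏa = k , sym m≡vᵏa

  cycleMin-least : ∀ a y → SameCycle v a y → toℕ (cycleMin a) ≤ toℕ y
  cycleMin-least a y ay with same-bounded v ay
  ... | k , k<n , refl = All.lookup (f[argmin]≤f[xs] {f = toℕ} a (orbit a))
                                    (∈-map⁺ (λ k → iter v k a) (∈-upTo⁺ k<n))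

  cycleMin-isCycleMin : ∀ a → T (isCycleMin v (cycleMin a))
  cycleMin-isCycleMin a = least⇒isCycleMin (cycleMin a)
    (λ y my → cycleMin-least a y (same-trans v (cycleMin-on-cycle a) my))

  cycleMin-unique : ∀ a x → SameCycle v a x → T (isCycleMin v x) → x ≡ cycleMin a
  cycleMin-unique a x ax t = Fin.toℕ-injective (≤-antisym
    (isCycleMin⇒least x t (cycleMin a) (same-trans v (same-sym v ax) (cycleMin-on-cycle a)))
    (cycleMin-least a x ax))

χ : Bool → ℕ
χ b = if b then 1 else 0

χ-true : ∀ {b} → T b → χ b ≡ 1
χ-true {true} _ = refl

χ-false : ∀ {b} → ¬ T b → χ b ≡ 0
χ-false {true}  ¬t = ⊥-elim (¬t tt)
χ-false {false} _  = refl

χ≤1 : ∀ b → χ b ≤ 1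
χ≤1 true  = ≤-refl
χ≤1 false = z≤n

T-ext : ∀ {p q} → (T p → T q) → (T q → T p) → p ≡ q
T-ext {true}  {true}  _ _ = refl
T-ext {true}  {false} f _ = ⊥-elim (f tt)
T-ext {false} {true}  _ g = ⊥-elim (g tt)
T-ext {false} {false} _ _ = refl

δ : ∀ {n} → Fin n → Fin n → ℕ
δ c x = χ (does (x ≟ c))

δ-other : ∀ {n} (c x : Fin n) → x ≢ c → δ c x ≡ 0
δ-other c x x≢c with x ≟ c
... | yes x≡c = ⊥-elim (x≢c x≡c)
... | no _ = refl

∑-δ : ∀ {n} (c : Fin n) → ∑ (δ c) ≡ 1
∑-δ {suc n} 0F       = cong suc (sum-replicate-zero n)
∑-δ {suc n} (fsuc c) = ∑-δ c

∑-≤ : ∀ {n} (f : Fin n → ℕ) → (∀ x → f x ≤ 1) → ∑ f ≤ n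
∑-≤ {zero}  f f≤1 = z≤n
∑-≤ {suc n} f f≤1 = +-mono-≤ (f≤1 0F) (∑-≤ (f ∘ fsuc) (f≤1 ∘ fsuc))

∑-ones : ∀ {n} (f : Fin n → ℕ) → (∀ x → f x ≡ 1) → ∑ f ≡ n
∑-ones {zero}  f f≡1 = refl
∑-ones {suc n} f f≡1 = cong₂ _+_ (f≡1 0F) (∑-ones (f ∘ fsuc) (f≡1 ∘ fsuc))

sum-tabulate : ∀ {n} (f : Fin n → ℕ) → List.sum (tabulate f) ≡ ∑ f
sum-tabulate {zero}  f = refl
sum-tabulate {suc n} f = cong (f 0F +_) (sum-tabulate (f ∘ fsuc))

leader : ∀ {n} → Permutation′ n → Fin n → ℕ
leader v x = χ (isCycleMin v x)

cyc-∑ : ∀ {n} (v : Permutation′ n) → cyc v ≡ ∑ (leader v)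
cyc-∑ v = trans (cong List.sum (map-tabulate (λ x → x) (leader v))) (sum-tabulate (leader v))

leader-on-cycle : ∀ {n} (v : Permutation′ n) a x → SameCycle v a x →
                  leader v x ≡ δ (cycleMin v a) x
leader-on-cycle v a x ax with x ≟ cycleMin v a
... | yes refl = χ-true (cycleMin-isCycleMin v a)
... | no x≢m = χ-false (λ t → x≢m (cycleMin-unique v a x ax t))

cyc≤n : ∀ {n} (v : Permutation′ n) → cyc v ≤ n
cyc≤n v = subst (_≤ _) (sym (cyc-∑ v)) (∑-≤ (leader v) (λ x → χ≤1 (isCycleMin v x)))

cyc-identity : ∀ {n} (v : Permutation′ n) → v ≈ id → cyc v ≡ n
cyc-identity v v≈id = trans (cyc-∑ v) (∑-ones (leader v) (λ x → χ-true (least⇒isCycleMin v x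
  (λ y xy → ≤-reflexive (cong toℕ (sym (fixed xy)))))))
  where
  fixed : ∀ {x y} → SameCycle v x y → y ≡ x
  fixed (zero , refl) = refl
  fixed (suc k , refl) = trans (v≈id _) (fixed (k , refl))

cyc-cong : ∀ {n} (v w : Permutation′ n) → v ≈ w → cyc v ≡ cyc w
cyc-cong {n} v w v≈w = cong List.sum (map-cong (λ x → cong χ (cong (foldr _∧_ true)
  (map-cong (λ k → cong (λ y → toℕ x ≤ᵇ toℕ y) (iter-cong k x)) (upTo n)))) (allFin n))
  where
  iter-cong : ∀ k x → iter v k x ≡ iter w k x
  iter-cong zero x = refl
  iter-cong (suc k) x = trans (v≈w _) (cong (ap w) (iter-cong k x))

-- If a and b lie on different
-- cycles of w, then u = (a b)·w merges those two cycles and leaves every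
-- other cycle of w untouched, so u has one cycle less.
module Merge {n : ℕ} (w u : Permutation′ n) (a b : Fin n)
             (u≈ : u ≈ transpose a b · w) (a≁b : ¬ SameCycle w a b) where

  unaffected : ∀ x → ¬ SameCycle w a x → ¬ SameCycle w b x → ∀ k → iter u k x ≡ iter w k x
  unaffected x a≁x b≁x zero    = refl
  unaffected x a≁x b≁x (suc k) = begin
    ap u (iter u k x)          ≡⟨ u≈ _ ⟩
    tr a b (ap w (iter u k x)) ≡⟨ cong (tr a b ∘ ap w) (unaffected x a≁x b≁x k) ⟩
    tr a b (iter w (suc k) x)  ≡⟨ tr-other a b _ (λ e → a≁x (same-sym w (suc k , e)))
                                                  (λ e → b≁x (same-sym w (suc k , e))) ⟩
    iter w (suc k) x           ∎
    where open ≡-Reasoning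

  -- Following u from a, one first runs through the w-cycle of a ...
  a-cycle-kept : ∀ k → SameCycle u a (iter w k a)
  a-cycle-kept zero = same-refl u a
  a-cycle-kept (suc k) with position a b (ap w (iter w k a))
  ... | at-i ≡a = subst (SameCycle u a) (sym ≡a) (same-refl u a)
  ... | at-j _ ≡b = ⊥-elim (a≁b (suc k , ≡b))
  ... | elsewhere ≢a ≢b = subst (SameCycle u a) (trans (u≈ _) (tr-other a b _ ≢a ≢b))
                            (same-step u (a-cycle-kept k))

  -- ... and where w would return to a, u continues to b ...
  a-reaches-b : SameCycle u a b
  a-reaches-b with period w a
  ... | suc p , _ , _ , wᵖa≡a = subst (SameCycle u a)
          (trans (u≈ _) (trans (cong (tr a b) wᵖa≡a) (tr-i a b))) (same-step u (a-cycle-kept p))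

  -- ... and then through the w-cycle of b.
  b-cycle-joined : ∀ k → SameCycle u a (iter w k b)
  b-cycle-joined zero = a-reaches-b
  b-cycle-joined (suc k) with position a b (ap w (iter w k b))
  ... | at-i ≡a = ⊥-elim (a≁b (same-sym w (suc k , ≡a)))
  ... | at-j _ ≡b = subst (SameCycle u a) (sym ≡b) a-reaches-b
  ... | elsewhere ≢a ≢b = subst (SameCycle u a) (trans (u≈ _) (tr-other a b _ ≢a ≢b))
                            (same-step u (b-cycle-joined k))

  merged : ∀ x → SameCycle w a x ⊎ SameCycle w b x → SameCycle u a x
  merged x (inj₁ (k , refl)) = a-cycle-kept k
  merged x (inj₂ (k , refl)) = b-cycle-joined k

  not-merged : ∀ x → ¬ SameCycle w a x → ¬ SameCycle w b x → ¬ SameCycle u a x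
  not-merged x a≁x b≁x ax with same-sym u ax
  ... | k , uᵏx≡a = a≁x (same-sym w (k , trans (sym (unaffected x a≁x b≁x k)) uᵏx≡a))

  leader-unaffected : ∀ x → ¬ SameCycle w a x → ¬ SameCycle w b x → leader u x ≡ leader w x
  leader-unaffected x a≁x b≁x = cong χ (T-ext
    (λ t → least⇒isCycleMin w x λ y (k , e) →
             isCycleMin⇒least u x t y (k , trans (unaffected x a≁x b≁x k) e))
    (λ t → least⇒isCycleMin u x λ y (k , e) →
             isCycleMin⇒least w x t y (k , trans (sym (unaffected x a≁x b≁x k)) e)))

  mᵃ mᵇ mᵘ : Fin n
  mᵃ = cycleMin w a
  mᵇ = cycleMin w b
  mᵘ = cycleMin u a

  -- The common part of the leader functions of w and u: on the merged cycles
  -- only the cycle minima contribute, mᵃ and mᵇ for w and mᵘ for u.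
  rest : Fin n → ℕ
  rest x with same-cycle? w a x | same-cycle? w b x
  ... | no _ | no _ = leader w x
  ... | _    | _    = 0

  off-a : ∀ x → ¬ SameCycle w a x → x ≢ mᵃ
  off-a x a≁x refl = a≁x (cycleMin-on-cycle w a)

  off-b : ∀ x → ¬ SameCycle w b x → x ≢ mᵇ
  off-b x b≁x refl = b≁x (cycleMin-on-cycle w b)

  leader-w : ∀ x → leader w x ≡ rest x + (δ mᵃ x + δ mᵇ x)
  leader-w x with same-cycle? w a x | same-cycle? w b x
  ... | yes ax | _ = begin
    leader w x            ≡⟨ leader-on-cycle w a x ax ⟩
    δ mᵃ x                ≡⟨ sym (+-identityʳ (δ mᵃ x)) ⟩
    δ mᵃ x + 0            ≡⟨ cong (δ mᵃ x +_) (sym (δ-other mᵇ x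
                               (off-b x (λ bx → a≁b (same-trans w ax (same-sym w bx)))))) ⟩
    δ mᵃ x + δ mᵇ x       ∎
    where open ≡-Reasoning
  ... | no a≁x | yes bx = begin
    leader w x            ≡⟨ leader-on-cycle w b x bx ⟩
    δ mᵇ x                ≡⟨ cong (_+ δ mᵇ x) (sym (δ-other mᵃ x (off-a x a≁x))) ⟩
    δ mᵃ x + δ mᵇ x       ∎
    where open ≡-Reasoning
  ... | no a≁x | no b≁x = sym (trans (cong (leader w x +_)
          (cong₂ _+_ (δ-other mᵃ x (off-a x a≁x)) (δ-other mᵇ x (off-b x b≁x)))) (+-identityʳ _))

  leader-u : ∀ x → leader u x ≡ rest x + δ mᵘ x
  leader-u x with same-cycle? w a x | same-cycle? w b x
  ... | yes ax | _ = leader-on-cycle u a x (merged x (inj₁ ax))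
  ... | no a≁x | yes bx = leader-on-cycle u a x (merged x (inj₂ bx))
  ... | no a≁x | no b≁x = trans (leader-unaffected x a≁x b≁x) (sym (trans
          (cong (leader w x +_) (δ-other mᵘ x (λ { refl → not-merged x a≁x b≁x (cycleMin-on-cycle u a) })))
          (+-identityʳ _)))

  merge : cyc w ≡ suc (cyc u)
  merge = begin
    cyc w                                    ≡⟨ cyc-∑ w ⟩
    ∑ (leader w)                             ≡⟨ sum-cong-≗ leader-w ⟩
    ∑ (λ x → rest x + (δ mᵃ x + δ mᵇ x))     ≡⟨ ∑-distrib-+ rest _ ⟩
    ∑ rest + ∑ (λ x → δ mᵃ x + δ mᵇ x)       ≡⟨ cong (∑ rest +_) (∑-distrib-+ (δ mᵃ) (δ mᵇ)) ⟩
    ∑ rest + (∑ (δ mᵃ) + ∑ (δ mᵇ))           ≡⟨ cong (∑ rest +_) (cong₂ _+_ (∑-δ mᵃ) (∑-δ mᵇ)) ⟩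
    ∑ rest + 2                               ≡⟨ +-suc (∑ rest) 1 ⟩
    suc (∑ rest + 1)                         ≡⟨ cong (suc ∘ (∑ rest +_)) (sym (∑-δ mᵘ)) ⟩
    suc (∑ rest + ∑ (δ mᵘ))                  ≡⟨ cong suc (sym (∑-distrib-+ rest (δ mᵘ))) ⟩
    suc (∑ (λ x → rest x + δ mᵘ x))          ≡⟨ cong suc (sym (sum-cong-≗ leader-u)) ⟩
    suc (∑ (leader u))                       ≡⟨ cong suc (sym (cyc-∑ u)) ⟩
    suc (cyc u)                              ∎
    where open ≡-Reasoning

-- If a and b lie on one cycle of w, then u = (a b)·w separates them: if
-- wʳ(a) = b is the first arrival, the u-orbit of a is a, w(a), …, wʳ⁻¹(a).
split : ∀ {n} (w u : Permutation′ n) (a b : Fin n) → a ≢ b →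
        u ≈ transpose a b · w → SameCycle w a b → ¬ SameCycle u a b
split w u a b a≢b u≈ ab (k , uᵏa≡b) with first-arrival w ab
... | r , wʳa≡b , misses =
  let (j , j<r , uᵏa≡wʲa) = within k in misses j j<r (trans (sym uᵏa≡wʲa) uᵏa≡b)
  where
  positive : ∀ {i} → iter w i a ≡ b → 0 < i
  positive {zero}  a≡b = ⊥-elim (a≢b a≡b)
  positive {suc _} _   = s≤s z≤n

  0<r : 0 < r
  0<r = positive wʳa≡b

  -- wʲ⁺¹(a) ≠ a for j + 1 < r, as otherwise b = w^(r-j-1)(a) would be reached earlier.
  no-early-return : ∀ j → suc j < r → iter w (suc j) a ≢ a
  no-early-return j sj<r wʲ⁺¹a≡a =
    misses (r ∸ suc j) (∸-monoʳ-< {o = 0} (s≤s z≤n) (<⇒≤ sj<r)) (begin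
    iter w (r ∸ suc j) a                    ≡⟨ cong (iter w (r ∸ suc j)) (sym wʲ⁺¹a≡a) ⟩
    iter w (r ∸ suc j) (iter w (suc j) a)   ≡⟨ sym (iter-+ w (r ∸ suc j) (suc j) a) ⟩
    iter w (r ∸ suc j + suc j) a            ≡⟨ cong (λ i → iter w i a) (m∸n+n≡m (<⇒≤ sj<r)) ⟩
    iter w r a                              ≡⟨ wʳa≡b ⟩
    b                                       ∎)
    where open ≡-Reasoning

  -- Invariant: uᵏ(a) is one of a, w(a), …, wʳ⁻¹(a).
  within : ∀ k → Σ ℕ λ j → j < r × iter u k a ≡ iter w j a
  within zero = 0 , 0<r , refl
  within (suc k) with within k
  ... | j , j<r , uᵏa≡wʲa with m≤n⇒m<n∨m≡n j<r
  ...   | inj₂ refl = 0 , 0<r , (begin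
    ap u (iter u k a)           ≡⟨ u≈ _ ⟩
    tr a b (ap w (iter u k a))  ≡⟨ cong (tr a b ∘ ap w) uᵏa≡wʲa ⟩
    tr a b (iter w (suc j) a)   ≡⟨ cong (tr a b) wʳa≡b ⟩
    tr a b b                    ≡⟨ tr-j a b ⟩
    a                           ∎)
    where open ≡-Reasoning
  ...   | inj₁ sj<r = suc j , sj<r , (begin
    ap u (iter u k a)           ≡⟨ u≈ _ ⟩
    tr a b (ap w (iter u k a))  ≡⟨ cong (tr a b ∘ ap w) uᵏa≡wʲa ⟩
    tr a b (iter w (suc j) a)   ≡⟨ tr-other a b _ (no-early-return j sj<r) (misses (suc j) sj<r) ⟩
    iter w (suc j) a            ∎)
    where open ≡-Reasoning

cyc-split : ∀ {n} (w u : Permutation′ n) (a b : Fin n) → a ≢ b →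
            u ≈ transpose a b · w → SameCycle w a b → cyc u ≡ suc (cyc w)
cyc-split w u a b a≢b u≈ ab = Merge.merge u w a b w≈ (split w u a b a≢b u≈ ab)
  where
  w≈ : w ≈ transpose a b · u
  w≈ y = trans (sym (tr-involutive a b (ap w y))) (cong (tr a b) (sym (u≈ y)))

cyc-step : ∀ {n} (w u : Permutation′ n) (a b : Fin n) → a ≢ b →
           u ≈ transpose a b · w → cyc u ≡ suc (cyc w) ⊎ cyc w ≡ suc (cyc u)
cyc-step w u a b a≢b u≈ with same-cycle? w a b
... | yes ab  = inj₁ (cyc-split w u a b a≢b u≈ ab)
... | no  a≁b = inj₂ (Merge.merge w u a b u≈ a≁b)

cyc-step-by : ∀ {n} (t w : Permutation′ n) → IsTransposition t →
              cyc (t · w) ≡ suc (cyc w) ⊎ cyc w ≡ suc (cyc (t · w))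
cyc-step-by t w (i , j , i≢j , t≈) = cyc-step w (t · w) i j i≢j (λ y → t≈ (ap w y))

cyc-prod-[] : ∀ {n} → cyc (prod {n} []) ≡ n
cyc-prod-[] {n} = cyc-identity (id {n}) (λ _ → refl)

transpositions-parity : ∀ {n} (ss : List (Permutation′ n)) → All IsTransposition ss →
                        parity (cyc (prod ss) + length ss) ≡ parity n
transpositions-parity {n} [] [] = cong parity (trans (+-identityʳ (cyc (prod {n} []))) (cyc-prod-[] {n}))
transpositions-parity {n} (s ∷ ss) (s-tr ∷ ss-tr) =
  trans (cong parity (+-suc (cyc (prod (s ∷ ss))) (length ss))) (step (cyc-step-by s (prod ss) s-tr))
  where
  -- cyc(s·P) + 1 + k is either cyc P + k + 2 or cyc P + k.
  step : cyc (prod (s ∷ ss)) ≡ suc (cyc (prod ss)) ⊎ cyc (prod ss) ≡ suc (cyc (prod (s ∷ ss))) →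
         parity (suc (cyc (prod (s ∷ ss))) + length ss) ≡ parity n
  step (inj₁ up)   = trans (cong (λ c → parity (suc c + length ss)) up) (transpositions-parity ss ss-tr)
  step (inj₂ down) =
    trans (cong (λ c → parity (c + length ss)) (sym down)) (transpositions-parity ss ss-tr)

transpositions-lower-bound : ∀ {n} (ss : List (Permutation′ n)) → All IsTransposition ss →
                             n ≤ cyc (prod ss) + length ss
transpositions-lower-bound {n} [] [] =
  ≤-reflexive (sym (trans (+-identityʳ (cyc (prod {n} []))) (cyc-prod-[] {n})))
transpositions-lower-bound {n} (s ∷ ss) (s-tr ∷ ss-tr) = begin
  n                                      ≤⟨ transpositions-lower-bound ss ss-tr ⟩
  cyc (prod ss) + length ss              ≤⟨ +-monoˡ-≤ (length ss) drop-at-most-one ⟩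
  suc (cyc (prod (s ∷ ss))) + length ss  ≡⟨ sym (+-suc (cyc (prod (s ∷ ss))) (length ss)) ⟩
  cyc (prod (s ∷ ss)) + length (s ∷ ss)  ∎
  where
  open ≤-Reasoning
  drop-at-most-one : cyc (prod ss) ≤ suc (cyc (prod (s ∷ ss)))
  drop-at-most-one with cyc-step-by s (prod ss) s-tr
  ... | inj₁ up   = ≤-trans (n≤1+n _) (≤-trans (n≤1+n _) (≤-reflexive (cong suc (sym up))))
  ... | inj₂ down = ≤-reflexive down

-- Conversely every v is a product of n − cyc v transpositions: peel off the
-- transposition (a v(a)) at a moved point a, which raises cyc by one.
identity-or-moved : ∀ {n} (v : Permutation′ n) → v ≈ id ⊎ ∃ λ a → ap v a ≢ a
identity-or-moved {n} v with Fin.all? (λ x → ap v x ≟ x)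
... | yes fixed = inj₁ fixed
... | no ¬fixed = inj₂ (Fin.¬∀⟶∃¬ n _ (λ x → ap v x ≟ x) ¬fixed)

peel : ∀ {n} (v : Permutation′ n) a → ap v a ≢ a → cyc (transpose a (ap v a) · v) ≡ suc (cyc v)
peel v a moved = cyc-split v (transpose a (ap v a) · v) a (ap v a) (≢-sym moved) (λ _ → refl) (1 , refl)

decompose : ∀ {n} d (v : Permutation′ n) → cyc v + d ≡ n →
            Σ (List (Permutation′ n)) λ ss → All IsTransposition ss × length ss ≡ d × v ≈ prod ss
decompose d v cyc+d≡n with identity-or-moved v
decompose zero    v _       | inj₁ v≈id = [] , [] , refl , v≈id
decompose (suc d) v cyc+d≡n | inj₁ v≈id =
  ⊥-elim (m+1+n≢m _ (trans (cong (_+ suc d) (sym (cyc-identity v v≈id))) cyc+d≡n))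
decompose {n} zero v cyc+0≡n | inj₂ (a , moved) =
  ⊥-elim (1+n≰n (subst (_≤ n) too-many (cyc≤n (transpose a (ap v a) · v))))
  where
  too-many : cyc (transpose a (ap v a) · v) ≡ suc n
  too-many = trans (peel v a moved) (cong suc (trans (sym (+-identityʳ (cyc v))) cyc+0≡n))
decompose (suc d) v cyc+d≡n | inj₂ (a , moved)
  with decompose d (transpose a (ap v a) · v)
         (trans (cong (_+ d) (peel v a moved)) (trans (sym (+-suc (cyc v) d)) cyc+d≡n))
... | ss , ss-tr , refl , peeled≈ss =
  transpose a (ap v a) ∷ ss , (a , ap v a , ≢-sym moved , λ _ → refl) ∷ ss-tr , refl ,
  λ x → trans (sym (tr-involutive a (ap v a) (ap v x))) (cong (tr a (ap v a)) (peeled≈ss x))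

even-parity : ∀ k → EvenNat k → parity k ≡ 0ℙ
even-parity zero          _    = refl
even-parity (suc zero)    ()
even-parity (suc (suc k)) even = even-parity k even

odd-parity : ∀ k → OddNat k → parity k ≡ 1ℙ
odd-parity zero          ()
odd-parity (suc zero)    _   = refl
odd-parity (suc (suc k)) odd = odd-parity k odd

parity-cancel : ∀ a b → parity (a + b) ≡ parity b → parity a ≡ 0ℙ
parity-cancel a b e = ℙ.+-cancelʳ-≡ (parity b) (parity a) 0ℙ (trans (sym (+-homo-+ a b)) e)

alternating-parity : ∀ {n} (v : Permutation′ n) → InAlternating v → parity (cyc v) ≡ parity n
alternating-parity {n} v (ss , ss-tr , even , v≈ss) = begin
  parity (cyc v)                                  ≡⟨ cong parity (cyc-cong v (prod ss) v≈ss) ⟩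
  parity (cyc (prod ss))                          ≡⟨ sym (ℙ.+-identityʳ _) ⟩
  parity (cyc (prod ss)) ℙ+ 0ℙ                    ≡⟨ cong (parity (cyc (prod ss)) ℙ+_)
                                                         (sym (even-parity (length ss) even)) ⟩
  parity (cyc (prod ss)) ℙ+ parity (length ss)    ≡⟨ sym (+-homo-+ (cyc (prod ss)) (length ss)) ⟩
  parity (cyc (prod ss) + length ss)              ≡⟨ transpositions-parity ss ss-tr ⟩
  parity n                                        ∎
  where open ≡-Reasoning

-- Writing v = σ(i₁ j₁)⋯σ(iₖ jₖ) and moving all
-- the σ's to the front conjugates each (i j) into another transposition.
module Twisting (m : ℕ) where

  private
    n : ℕ
    n = suc (suc m)

  σ : Permutation′ n
  σ = transpose 0F 1F

  -- σ^p for p ∈ ℤ/2; σ^(parity k) is σᵏ.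
  σ^ : Parity → Permutation′ n
  σ^ 0ℙ = id
  σ^ 1ℙ = σ

  σ^-involutive : ∀ p x → ap (σ^ p) (ap (σ^ p) x) ≡ x
  σ^-involutive 0ℙ x = refl
  σ^-involutive 1ℙ x = tr-involutive 0F 1F x

  σ^-injective : ∀ p {x y} → ap (σ^ p) x ≡ ap (σ^ p) y → x ≡ y
  σ^-injective p {x} {y} e =
    trans (sym (σ^-involutive p x)) (trans (cong (ap (σ^ p)) e) (σ^-involutive p y))

  σ^-suc : ∀ k x → ap (σ^ (parity (suc k))) x ≡ ap σ (ap (σ^ (parity k)) x)
  σ^-suc zero          x = refl
  σ^-suc (suc zero)    x = sym (tr-involutive 0F 1F x)
  σ^-suc (suc (suc k)) x = σ^-suc k x

  σ^-suc-σ : ∀ k x → ap (σ^ (parity (suc k))) (ap σ x) ≡ ap (σ^ (parity k)) x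
  σ^-suc-σ zero          x = tr-involutive 0F 1F x
  σ^-suc-σ (suc zero)    x = refl
  σ^-suc-σ (suc (suc k)) x = σ^-suc-σ k x

  σ^-shift : ∀ q p x → ap (σ^ (q ℙ+ p)) (ap (σ^ p) x) ≡ ap (σ^ q) x
  σ^-shift 0ℙ 0ℙ x = refl
  σ^-shift 0ℙ 1ℙ x = tr-involutive 0F 1F x
  σ^-shift 1ℙ 0ℙ x = refl
  σ^-shift 1ℙ 1ℙ x = refl

  σ^-rebase : ∀ v p w → w ≈ σ^ p · v → ∀ q → σ^ q · v ≈ σ^ (q ℙ+ p) · w
  σ^-rebase v p w w≈ q x = sym (trans (cong (ap (σ^ (q ℙ+ p))) (w≈ x)) (σ^-shift q p (ap v x)))

  T-element : ∀ {i j} → i ≢ j → Σ (Permutation′ n) λ t → InT t × (∀ x → ap t x ≡ ap σ (tr i j x))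
  T-element {i} {j} i≢j with Fin.<-cmp i j
  ... | tri< i<j _ _ = σ · transpose i j , (0F , 1F , i , j , refl , refl , i<j , λ _ → refl) ,
                       λ _ → refl
  ... | tri≈ _ i≡j _ = ⊥-elim (i≢j i≡j)
  ... | tri> _ _ j<i = σ · transpose j i , (0F , 1F , j , i , refl , refl , j<i , λ _ → refl) ,
                       λ x → cong (ap σ) (tr-sym j i x)

  T-action : ∀ {t} → InT t → Σ (Fin n) λ i → Σ (Fin n) λ j → i ≢ j × (∀ x → ap t x ≡ ap σ (tr i j x))
  T-action (a , b , i , j , a≡0 , b≡1 , i<j , t≈) = i , j , <⇒≢ i<j ∘ cong toℕ ,
    λ x → trans (t≈ x) (cong₂ (λ a b → tr a b (tr i j x))
                              (Fin.toℕ-injective a≡0) (Fin.toℕ-injective b≡1))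

  untwist : ∀ ts → All InT ts →
            Σ (List (Permutation′ n)) λ ss → All IsTransposition ss × length ss ≡ length ts ×
              σ^ (parity (length ts)) · prod ts ≈ prod ss
  untwist [] [] = [] , [] , refl , λ _ → refl
  untwist (t ∷ ts) (t-T ∷ ts-T) with T-action {t} t-T | untwist ts ts-T
  ... | i , j , i≢j , t≈ | ss , ss-tr , len , twisted =
    transpose (g i) (g j) ∷ ss , (g i , g j , i≢j ∘ σ^-injective p , λ _ → refl) ∷ ss-tr , cong suc len ,
    λ x → begin
      ap (σ^ (parity (suc L))) (ap t (ap P x))          ≡⟨ cong (ap (σ^ (parity (suc L)))) (t≈ (ap P x)) ⟩
      ap (σ^ (parity (suc L))) (ap σ (tr i j (ap P x))) ≡⟨ σ^-suc-σ L (tr i j (ap P x)) ⟩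
      g (tr i j (ap P x))                               ≡⟨ tr-conj g (σ^-injective p) i j (ap P x) ⟩
      tr (g i) (g j) (g (ap P x))                       ≡⟨ cong (tr (g i) (g j)) (twisted x) ⟩
      tr (g i) (g j) (ap (prod ss) x)                   ∎
    where
    open ≡-Reasoning
    L = length ts
    P = prod ts
    p = parity L
    g = ap (σ^ p)

  twist : ∀ ss → All IsTransposition ss →
          Σ (List (Permutation′ n)) λ ts → All InT ts × length ts ≡ length ss ×
            prod ts ≈ σ^ (parity (length ss)) · prod ss
  twist [] [] = [] , [] , refl , λ _ → refl
  twist (s ∷ ss) ((i , j , i≢j , s≈) ∷ ss-tr) with twist ss ss-tr
  ... | ts , ts-T , len , twisted
    with T-element {ap (σ^ (parity (length ss))) i} {ap (σ^ (parity (length ss))) j}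
                   (i≢j ∘ σ^-injective (parity (length ss)))
  ... | t , t-T , t≈ = t ∷ ts , t-T ∷ ts-T , cong suc len , λ x → begin
      ap t (ap (prod ts) x)                         ≡⟨ t≈ (ap (prod ts) x) ⟩
      ap σ (tr (g i) (g j) (ap (prod ts) x))        ≡⟨ cong (ap σ ∘ tr (g i) (g j)) (twisted x) ⟩
      ap σ (tr (g i) (g j) (g (ap P x)))            ≡⟨ cong (ap σ) (sym (tr-conj g g-inj i j (ap P x))) ⟩
      ap σ (g (tr i j (ap P x)))                    ≡⟨ sym (σ^-suc L (tr i j (ap P x))) ⟩
      ap (σ^ (parity (suc L))) (tr i j (ap P x))    ≡⟨ cong (ap (σ^ (parity (suc L)))) (sym (s≈ (ap P x))) ⟩
      ap (σ^ (parity (suc L))) (ap s (ap P x))      ∎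
    where
    open ≡-Reasoning
    L = length ss
    P = prod ss
    p = parity L
    g = ap (σ^ p)
    g-inj = σ^-injective p

  -- If 0 and 1 lie on different cycles of w, multiplying by σ merges them, so
  -- no σ^r·w has more cycles than w.
  separated-max : ∀ w → ¬ SameCycle w 0F 1F → ∀ r → cyc (σ^ r · w) ≤ cyc w
  separated-max w apart 0ℙ = ≤-reflexive (cyc-cong (σ^ 0ℙ · w) w (λ _ → refl))
  separated-max w apart 1ℙ =
    ≤-trans (n≤1+n _) (≤-reflexive (sym (Merge.merge w (σ · w) 0F 1F (λ _ → refl) apart)))

  -- Choose p with 0, 1 on different cycles of w = σ^p·v
  -- and n − cyc w ≡ p (mod 2).  Then v = σ^p·w is a product of n − cyc w
  -- elements of T (twist a minimal factorisation of w), and no shorter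
  -- product exists: if v = t₁⋯tₖ, then σᵏ·v is a product of k transpositions,
  -- so n − k ≤ cyc(σᵏ·v) ≤ cyc w.
  T-length : ∀ v p w → w ≈ σ^ p · v → ¬ SameCycle w 0F 1F → parity (n ∸ cyc w) ≡ p →
             IsTLength v (n ∸ cyc w)
  T-length v p w w≈ apart ℓ≡p = product , minimal
    where
    product : ProductOfT v (n ∸ cyc w)
    product with decompose (n ∸ cyc w) w (m+[n∸m]≡n (cyc≤n w))
    ... | ss , ss-tr , len , w≈ss with twist ss ss-tr
    ... | ts , ts-T , len′ , twisted = ts , ts-T , trans len′ len , λ x → sym (begin
      ap (prod ts) x                                  ≡⟨ twisted x ⟩
      ap (σ^ (parity (length ss))) (ap (prod ss) x)   ≡⟨ cong (λ L → ap (σ^ L) (ap (prod ss) x))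
                                                            (trans (cong parity len) ℓ≡p) ⟩
      ap (σ^ p) (ap (prod ss) x)                      ≡⟨ cong (ap (σ^ p)) (trans (sym (w≈ss x)) (w≈ x)) ⟩
      ap (σ^ p) (ap (σ^ p) (ap v x))                  ≡⟨ σ^-involutive p (ap v x) ⟩
      ap v x                                          ∎)
      where open ≡-Reasoning

    minimal : ∀ k → ProductOfT v k → n ∸ cyc w ≤ k
    minimal k (ts , ts-T , refl , v≈ts) with untwist ts ts-T
    ... | ss , ss-tr , len , untwisted = m≤n+o⇒m∸n≤o n (cyc w) (begin
      n                           ≤⟨ transpositions-lower-bound ss ss-tr ⟩
      cyc (prod ss) + length ss   ≡⟨ cong₂ _+_ (cyc-cong (prod ss) (σ^ q · v) twisted-v) len ⟩
      cyc (σ^ q · v) + k          ≡⟨ cong (_+ k) (cyc-cong _ (σ^ (q ℙ+ p) · w) (σ^-rebase v p w w≈ q)) ⟩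
      cyc (σ^ (q ℙ+ p) · w) + k   ≤⟨ +-monoˡ-≤ k (separated-max w apart (q ℙ+ p)) ⟩
      cyc w + k                   ∎)
      where
      open ≤-Reasoning
      q = parity k
      twisted-v : prod ss ≈ σ^ q · v
      twisted-v x = sym (trans (cong (ap (σ^ q)) (v≈ts x)) (untwisted x))

  LengthFormula : Permutation′ n → Set
  LengthFormula v = Σ ℕ λ ℓ → IsTLength v ℓ ×
    (EvenNat ℓ → cyc v ≡ n ∸ ℓ) × (OddNat ℓ → cyc v ≡ n ∸ ℓ ∸ 1)

  -- 0 and 1 on different cycles of v: ℓ = n − cyc v, which is even.
  formula-separated : ∀ v → parity (cyc v) ≡ parity n → ¬ SameCycle v 0F 1F → LengthFormula v
  formula-separated v cyc≡n apart =
    ℓ , T-length v 0ℙ v (λ _ → refl) apart ℓ-even ,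
    (λ _ → sym (m∸[m∸n]≡n (cyc≤n v))) ,
    (λ odd → ⊥-elim (ℙ.p≢p⁻¹ 0ℙ (trans (sym ℓ-even) (odd-parity ℓ odd))))
    where
    ℓ = n ∸ cyc v
    ℓ-even : parity ℓ ≡ 0ℙ
    ℓ-even = parity-cancel ℓ (cyc v) (trans (cong parity (m∸n+n≡m (cyc≤n v))) (sym cyc≡n))

  -- 0 and 1 on one cycle of v: σ·v separates them and has one more cycle, so
  -- ℓ = n − cyc v − 1, which is odd.
  formula-joined : ∀ v → parity (cyc v) ≡ parity n → SameCycle v 0F 1F → LengthFormula v
  formula-joined v cyc≡n together =
    ℓ , T-length v 1ℙ (σ · v) (λ _ → refl) apart ℓ-odd ,
    (λ even → ⊥-elim (ℙ.p≢p⁻¹ 0ℙ (trans (sym (even-parity ℓ even)) ℓ-odd))) ,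
    (λ _ → sym (cong (_∸ 1) (trans (m∸[m∸n]≡n (cyc≤n (σ · v))) more)))
    where
    apart : ¬ SameCycle (σ · v) 0F 1F
    apart = split v (σ · v) 0F 1F (λ ()) (λ _ → refl) together
    more : cyc (σ · v) ≡ suc (cyc v)
    more = cyc-split v (σ · v) 0F 1F (λ ()) (λ _ → refl) together
    ℓ = n ∸ cyc (σ · v)
    ℓ-odd : parity ℓ ≡ 1ℙ
    ℓ-odd = trans (sym (suc-homo-⁻¹ ℓ))
      (cong _⁻¹ (parity-cancel (suc ℓ) (cyc v) (trans (cong parity 1+ℓ+cyc) (sym cyc≡n))))
      where
      open ≡-Reasoning
      1+ℓ+cyc : suc ℓ + cyc v ≡ n
      1+ℓ+cyc = begin
        suc ℓ + cyc v     ≡⟨ sym (+-suc ℓ (cyc v)) ⟩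
        ℓ + suc (cyc v)   ≡⟨ cong (ℓ +_) (sym more) ⟩
        ℓ + cyc (σ · v)   ≡⟨ m∸n+n≡m (cyc≤n (σ · v)) ⟩
        n                 ∎

-- Theorem 6.3.  Split on whether 1 and 2 (here 0F and 1F) share a cycle of v.
-- The bound 3 ≤ n only guarantees these two points; the argument needs n ≥ 2.
theorem6p3 : (n : ℕ) → 3 ≤ n → (v : Permutation′ n) → InAlternating v →
    Σ ℕ λ ℓ → IsTLength v ℓ ×
      (EvenNat ℓ → cyc v ≡ n ∸ ℓ) × (OddNat ℓ → cyc v ≡ n ∸ ℓ ∸ 1)
theorem6p3 (suc (suc m)) _ v v∈Aₙ with same-cycle? v 0F 1F
... | yes together = Twisting.formula-joined m v (alternating-parity v v∈Aₙ) together
... | no  apart    = Twisting.formula-separated m v (alternating-parity v v∈Aₙ) apart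
theorem6p3 (suc zero) (s≤s ()) v _
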